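{- Let $G$ be a graph and $r$ a positive integer. Let $L_S$ be a subordering of $S\subseteq V(G)$ with free vertices $T=V(G)\setminus S$, and let $L_{S'}$ be a left extension of $L_S$. Then for all $v\in S$, \[\mathrm{PotSreach}_r(G,L_S,v)\subseteq \mathrm{PotSreach}_r(G,L_{S'},v).\]
   Context: All graphs are finite, simple and undirected. The length of a path is its number of edges (a single vertex is a path of length $0$). A subordering $L_S$ of a graph $G$ is a linear ordering of a subset $S\subseteq V(G)$; we write $u\preceq_{L_S} w$ if $u=w$ or $u$ precedes $w$. For a graph $H$ and a linear ordering $L$ of all of $V(H)$, $u\in\mathrm{Wreach}_r(H,L,x)$ means there is a path $P$ in $H$ between $u$ and $x$ of length at most $r$ with $u\preceq_L w$ for all $w\in V(P)$. For a subordering $L_S$ with free vertices $T=V(G)\setminus S$ and $v\in S$, a vertex $u$ is potentially strongly $r$-reachable from $v$ w.r.t. $L_S$ if $u\in\mathrm{Wreach}_r(G[S],L_S,v)$ or there is a path $P$ in $G$ of length at most $r$ from $v$ to $u$ with $V(P)\cap T=\{u\}$; $\mathrm{PotSreach}_r(G,L_S,v)$ is the set of such $u$. A subordering $L_{S'}$ is a left extension of $L_S$ if $S'\supseteq S$, $L_{S'}$ restricted to $S$ equals $L_S$, and $u\preceq_{L_{S'}} w$ for all $u\in S'\setminus S$ and $w\in S$. -}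

module Defs where

open import Data.Nat using (ℕ; suc; _≤_)
open import Data.Fin using (Fin)
open import Data.List using (List; []; _∷_; length)
open import Data.List.Membership.Propositional using (_∈_; _∉_)
open import Data.List.Relation.Unary.All using (All)
open import Data.List.Relation.Unary.Unique.Propositional using (Unique)
open import Data.Product using (Σ; _×_; ∃-syntax)
open import Data.Sum using (_⊎_)
open import Relation.Binary.PropositionalEquality using (_≡_)
open import Relation.Nullary using (¬_)

record Graph : Set₁ where
  field
    n      : ℕ
    Adj    : Fin n → Fin n → Set
    sym    : ∀ {x y} → Adj x y → Adj y x
    irrefl : ∀ {x} → ¬ Adj x x

open Graph public

V : Graph → Set
V G = Fin (n G)

-- A subordering of G: a linear ordering of a subset S ⊆ V(G), represented
-- as a duplicate-free list (earlier in the list = earlier in the order).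
-- S is the set of entries of the list.
record Subordering (G : Graph) : Set where
  constructor mkSub
  field
    order  : List (V G)
    unique : Unique order

open Subordering public

_∈S_ : ∀ {G} → V G → Subordering G → Set
x ∈S L = x ∈ order L

-- u ⪯ w : u = w or u precedes w (both in the list)
data Prec {A : Set} : List A → A → A → Set where
  here  : ∀ {x xs w} → w ∈ (x ∷ xs) → Prec (x ∷ xs) x w
  there : ∀ {x xs u w} → Prec xs u w → Prec (x ∷ xs) u w

_⪯[_]_ : ∀ {G} → V G → Subordering G → V G → Set
u ⪯[ L ] w = Prec (order L) u w

data Walk (G : Graph) : V G → V G → List (V G) → Set where
  nil  : ∀ {x} → Walk G x x (x ∷ [])
  cons : ∀ {x y z vs} → Adj G x y → Walk G y z vs → Walk G x z (x ∷ vs)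

-- A path from x to y of length (number of edges) at most r, with vertex list vs.
PathLe : (G : Graph) → ℕ → V G → V G → List (V G) → Set
PathLe G r x y vs = Walk G x y vs × Unique vs × length vs ≤ suc r

-- u ∈ Wreach_r(G[S], L_S, x): a path in G[S] between u and x of length ≤ r
-- all of whose vertices w satisfy u ⪯ w.  (u ⪯ u forces u ∈ S.)
Wreach : (G : Graph) → ℕ → Subordering G → V G → V G → Set
Wreach G r L x u =
  ∃[ vs ] (PathLe G r u x vs × All (_∈S L) vs × All (λ w → u ⪯[ L ] w) vs)

PotSreach : (G : Graph) → ℕ → Subordering G → V G → V G → Set
PotSreach G r L v u =
  Wreach G r L v u
  ⊎ ∃[ vs ] (PathLe G r v u vs × ¬ (u ∈S L)
             × All (λ w → w ≡ u ⊎ w ∈S L) vs)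

record LeftExtension {G : Graph} (L' L : Subordering G) : Set where
  field
    superset : ∀ {x} → x ∈S L → x ∈S L'
    restrict : ∀ {u w} → u ∈S L → w ∈S L → (u ⪯[ L ] w → u ⪯[ L' ] w) × (u ⪯[ L' ] w → u ⪯[ L ] w)
    newFirst : ∀ {u w} → u ∈S L' → ¬ (u ∈S L) → w ∈S L → u ⪯[ L' ] w

-- Going from L_S to a left extension L_S' only prepends new vertices, which precede
-- every old one.  So a weak-reachability witness for L_S stays one for L_S', and a path
-- to a free vertex u either still ends at a free vertex, or u now belongs to S' and the
-- reversed path witnesses u ∈ Wreach_r(G[S'], L_S', v): every other vertex lies in S,
-- hence after u.
module Submission where

open import Defs
open import Data.Nat using (ℕ; _≤_)
open import Data.Fin.Properties using (_≟_)
open import Data.List using (List; _∷ʳ_; reverse)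
open import Data.List.Properties using (unfold-reverse; length-reverse)
open import Data.List.Membership.Propositional using (_∈_)
import Data.List.Membership.DecPropositional as DecMembership
open import Data.List.Relation.Unary.Any using (here; there)
open import Data.List.Relation.Unary.All as All using (All)
open import Data.List.Relation.Unary.Unique.Propositional using (Unique)
open import Data.List.Relation.Binary.Permutation.Propositional using (↭-sym)
open import Data.List.Relation.Binary.Permutation.Propositional.Properties
  using (All-resp-↭; ↭-reverse)
import Data.List.Relation.Binary.Permutation.Setoid as Perm
import Data.List.Relation.Binary.Permutation.Setoid.Properties as PermProperties
open import Data.Product using (_,_; proj₁)
open import Data.Sum using (_⊎_; inj₁; inj₂)
open import Relation.Binary.PropositionalEquality using (_≡_; refl; subst; setoid) renaming (sym to ≡-sym)
open import Relation.Nullary using (¬_; yes; no)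

All-reverse : ∀ {A : Set} {P : A → Set} {xs : List A} → All P xs → All P (reverse xs)
All-reverse {xs = xs} = All-resp-↭ (↭-sym (↭-reverse xs))

Unique-reverse : ∀ {A : Set} {xs : List A} → Unique xs → Unique (reverse xs)
Unique-reverse {A} {xs} =
  PermProperties.Unique-resp-↭ (setoid A) (Perm.↭-sym (setoid A) (PermProperties.↭-reverse (setoid A) xs))

Prec-refl : ∀ {A : Set} {xs : List A} {x} → x ∈ xs → Prec xs x x
Prec-refl (here refl) = here (here refl)
Prec-refl (there x∈xs) = there (Prec-refl x∈xs)

module _ {G : Graph} where

  Walk-source∈ : ∀ {x y vs} → Walk G x y vs → x ∈ vs
  Walk-source∈ nil = here refl
  Walk-source∈ (cons _ _) = here refl

  Walk-∷ʳ : ∀ {x y z vs} → Walk G x y vs → Adj G y z → Walk G x z (vs ∷ʳ z)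
  Walk-∷ʳ nil yz = cons yz nil
  Walk-∷ʳ (cons xw w) yz = cons xw (Walk-∷ʳ w yz)

  Walk-reverse : ∀ {x y vs} → Walk G x y vs → Walk G y x (reverse vs)
  Walk-reverse nil = nil
  Walk-reverse (cons {x} {_} {y} {vs} xw w) =
    subst (Walk G y x) (≡-sym (unfold-reverse x vs)) (Walk-∷ʳ (Walk-reverse w) (Graph.sym G xw))

  PathLe-reverse : ∀ {r x y vs} → PathLe G r x y vs → PathLe G r y x (reverse vs)
  PathLe-reverse {vs = vs} (w , uniq , len) =
    Walk-reverse w , Unique-reverse uniq , subst (_≤ _) (≡-sym (length-reverse vs)) len

  module _ {L L' : Subordering G} (ext : LeftExtension L' L) where
    open LeftExtension ext

    Wreach-leftExtension : ∀ {r x u} → Wreach G r L x u → Wreach G r L' x u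
    Wreach-leftExtension (vs , path@(w , _) , inS , afterU) =
      vs , path , All.map superset inS ,
      All.zipWith (λ (wS , u⪯w) → proj₁ (restrict uS wS) u⪯w) (inS , afterU)
      where uS = All.lookup inS (Walk-source∈ w)

    anchored-leftExtension : ∀ {u vs} → All (λ w → w ≡ u ⊎ w ∈S L) vs → All (λ w → w ≡ u ⊎ w ∈S L') vs
    anchored-leftExtension = All.map λ { (inj₁ w≡u) → inj₁ w≡u ; (inj₂ wS) → inj₂ (superset wS) }

    freePath⇒Wreach : ∀ {r v u vs} → u ∈S L' → ¬ (u ∈S L) → PathLe G r v u vs →
                      All (λ w → w ≡ u ⊎ w ∈S L) vs → Wreach G r L' v u
    freePath⇒Wreach {vs = vs} uS' u∉S path anchored =
      reverse vs , PathLe-reverse path ,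
      All-reverse (All.map (λ { (inj₁ refl) → uS' ; (inj₂ wS) → superset wS }) anchored) ,
      All-reverse (All.map (λ { (inj₁ refl) → Prec-refl uS' ; (inj₂ wS) → newFirst uS' u∉S wS }) anchored)

lemma11 : (G : Graph) (r : ℕ) → 1 ≤ r → (L L' : Subordering G) → LeftExtension L' L →
            ∀ v → v ∈S L → ∀ u → PotSreach G r L v u → PotSreach G r L' v u
lemma11 G r _ L L' ext v _ u (inj₁ wreach) = inj₁ (Wreach-leftExtension ext wreach)
lemma11 G r _ L L' ext v _ u (inj₂ (vs , path , u∉S , anchored)) with DecMembership._∈?_ _≟_ u (order L')
... | yes uS' = inj₁ (freePath⇒Wreach ext uS' u∉S path anchored)
... | no u∉S' = inj₂ (vs , path , u∉S' , anchored-leftExtension ext anchored)
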